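{- If $N$ is a minor of the matroid $M$, then $\kappa(N)\le\kappa(M)$.
   Context: A non-basis of a matroid $M$ is a set of size $r(M)$ that is not a basis. A flat $F$ of $M$ covers a set $X$ if $|X\cap F|>r_M(F)$. A flat cover of $M$ is a set of flats of $M$ such that every non-basis of $M$ is covered by some member. The cover complexity $\kappa(M)$ is the minimum size of a flat cover of $M$. -}

module Defs where

open import Data.Nat using (ℕ; _≤_; _<_; _+_; _∸_)
open import Data.Bool using (if_then_else_)
open import Data.Fin using (Fin)
open import Data.Fin.Subset using (Subset; _∪_; _∩_; _⊆_; _∈_; _∉_; ⁅_⁆; ⊤; ⊥; ⋃; ∣_∣)
open import Data.List using (List; map; length; allFin)
open import Data.List.Membership.Propositional using () renaming (_∈_ to _∈ₗ_)
open import Data.List.Relation.Unary.Unique.Propositional using (Unique)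
open import Data.List.Relation.Unary.All using (All)
open import Data.Vec using (lookup)
open import Data.Product using (Σ; _×_; ∃)
open import Relation.Nullary using (¬_)
open import Relation.Binary.PropositionalEquality using (_≡_)
open import Function.Definitions using (Injective)

record Matroid (n : ℕ) : Set where
  field
    rank      : Subset n → ℕ
    rank-≤    : ∀ X → rank X ≤ ∣ X ∣
    rank-mono : ∀ {X Y} → X ⊆ Y → rank X ≤ rank Y
    rank-sub  : ∀ X Y → rank (X ∪ Y) + rank (X ∩ Y) ≤ rank X + rank Y

open Matroid public

module _ {n : ℕ} (M : Matroid n) where

  r : ℕ
  r = rank M ⊤

  Independent : Subset n → Set
  Independent X = rank M X ≡ ∣ X ∣

  IsBasis : Subset n → Set
  IsBasis X = Independent X × ∣ X ∣ ≡ r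

  NonBasis : Subset n → Set
  NonBasis X = ∣ X ∣ ≡ r × ¬ IsBasis X

  IsFlat : Subset n → Set
  IsFlat F = ∀ e → e ∉ F → rank M F < rank M (F ∪ ⁅ e ⁆)

  Covers : Subset n → Subset n → Set
  Covers F X = rank M F < ∣ X ∩ F ∣

  -- A flat cover: a (duplicate-free list representing a) set of flats such
  -- that every non-basis is covered by some member. Its size is its length.
  IsFlatCover : List (Subset n) → Set
  IsFlatCover 𝓕 = Unique 𝓕 × All IsFlat 𝓕
                × (∀ X → NonBasis X → ∃ λ F → F ∈ₗ 𝓕 × Covers F X)

  IsCoverComplexity : ℕ → Set
  IsCoverComplexity k =
    (Σ (List (Subset n)) λ 𝓕 → IsFlatCover 𝓕 × length 𝓕 ≡ k)
    × (∀ 𝓕 → IsFlatCover 𝓕 → k ≤ length 𝓕)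

image : {m n : ℕ} → (Fin m → Fin n) → Subset m → Subset n
image {m} ι X = ⋃ (map (λ i → if lookup X i then ⁅ ι i ⁆ else ⊥) (allFin m))

-- N (on Fin m) is a minor of M (on Fin n): N is isomorphic to M / C \ D,
-- where C ⊆ E(M) is contracted, the elements of E(M) outside C and outside
-- the image of ι are deleted, and ι : E(N) → E(M) is the relabelling
-- (injective, with image disjoint from C).  Rank of M / C restricted:
-- r_N(X) = r_M(ι X ∪ C) - r_M(C).
record IsMinor {m n : ℕ} (N : Matroid m) (M : Matroid n) : Set where
  field
    ι        : Fin m → Fin n
    ι-inj    : Injective _≡_ _≡_ ι
    C        : Subset n
    disjoint : ∀ i → ι i ∉ C
    rank-eq  : ∀ X → rank N X ≡ rank M (image ι X ∪ C) ∸ rank M C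

module Submission where

-- Write N = (M / C) restricted to ι(E(N)), let A = ι(E(N)) ∪ C, let I be a basis of C
-- and J a basis of M / A.  A set X of N lifts to Y = ι X ∪ I ∪ J, which has size r(M)
-- exactly when X has size r(N), and is a non-basis of M when X is a non-basis of N.
-- A flat F of M restricts to the closure in N of ι⁻¹(F).  If F covers Y, then
-- submodularity (K = J ∩ F stays independent over ι(ι⁻¹ F) ∪ C ⊆ A, and I spans C)
-- shows that the restriction of F covers X.  So restricting a flat cover of M gives a
-- flat cover of N with at most as many members.

open import Defs
open import Data.Nat using (ℕ; zero; suc; _≤_; _<_; _+_; _∸_; _≤?_)
open import Data.Nat.Properties hiding (suc-injective)
open import Data.Nat.Tactic.RingSolver using (solve-∀)
import Data.Bool as Bool
open import Data.Bool using (true; false; if_then_else_)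
open import Data.Bool.Properties using (T-≡)
open import Data.Fin using (Fin; zero; suc) renaming (_≟_ to _≟ᶠ_)
open import Data.Fin.Properties using (suc-injective)
open import Data.Fin.Subset
  using (Subset; _∪_; _∩_; _─_; _-_; _⊆_; _∈_; _∉_; ⁅_⁆; ⊤; ⊥; ⋃; ∣_∣)
open import Data.Fin.Subset.Properties
  using ( ∉⊥; ⊥⊆; ⊆⊤; ∣⊥∣≡0; x∈⁅x⁆; x∈⁅y⁆⇒x≡y; ∣⁅x⁆∣≡1; ⊆-refl; ⊆-trans; ⊆-reflexive
        ; p⊆q⇒∣p∣≤∣q∣; p⊆p∪q; q⊆p∪q; p∩q⊆q; x∈p∪q⁻; x∈p∪q⁺; x∈p∩q⁺; x∈p∩q⁻
        ; x∈p∧x∉q⇒x∈p─q; x∈p∧x≢y⇒x∈p-y; x∈p⇒∣p-x∣<∣p∣; ∪-identityˡ; ∪-assoc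
        ; ∩-distribʳ-∪; Empty-unique; _∈?_ )
open import Data.Vec using (_∷_; []; lookup; tabulate)
open import Data.Vec.Properties using ([]=⇒lookup; lookup⇒[]=; lookup∘tabulate; ≡-dec)
open import Data.List using (List; map; length; allFin; deduplicate)
open import Data.List.Properties using (map-tabulate; length-deduplicate; length-map)
open import Data.List.Membership.Propositional using () renaming (_∈_ to _∈ₗ_)
open import Data.List.Membership.Propositional.Properties
  using (∈-map⁺; ∈-map⁻; ∈-allFin; ∈-deduplicate⁺)
open import Data.List.Relation.Unary.Any using (here; there)
open import Data.List.Relation.Unary.All as All using (All)
open import Data.List.Relation.Unary.All.Properties using (map⁺; deduplicate⁺)
open import Data.Product using (_×_; ∃; _,_)
open import Data.Sum using (inj₁; inj₂)
open import Data.Empty using (⊥-elim)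
open import Function using (_∘_; id)
open import Function.Bundles using (Equivalence)
open import Function.Definitions using (Injective)
open import Relation.Nullary using (¬_; Dec; yes; no)
open import Relation.Nullary.Decidable using (isYes; toWitness; fromWitness)
open import Relation.Binary.Definitions using (DecidableEquality)
open import Relation.Binary.PropositionalEquality
  using (_≡_; refl; sym; trans; cong; cong₂; subst; module ≡-Reasoning)

m∸n<o⇒m<o+n : ∀ {m n o} → n ≤ m → m ∸ n < o → m < o + n
m∸n<o⇒m<o+n {n = n} n≤m m∸n<o = subst (_< _ + n) (m∸n+n≡m n≤m) (+-monoˡ-< n m∸n<o)

m<o+n⇒m∸n<o : ∀ {m n o} → n ≤ m → m < o + n → m ∸ n < o
m<o+n⇒m∸n<o {m} {n} {o} n≤m m<o+n =
  +-cancelʳ-< n (m ∸ n) o (subst (_< o + n) (sym (m∸n+n≡m n≤m)) m<o+n)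

module _ {n : ℕ} where

  ∪-lub : {p q r : Subset n} → p ⊆ r → q ⊆ r → p ∪ q ⊆ r
  ∪-lub {p} {q} p⊆r q⊆r x∈p∪q with x∈p∪q⁻ p q x∈p∪q
  ... | inj₁ x∈p = p⊆r x∈p
  ... | inj₂ x∈q = q⊆r x∈q

  ∪-mono : {p p′ q q′ : Subset n} → p ⊆ p′ → q ⊆ q′ → p ∪ q ⊆ p′ ∪ q′
  ∪-mono {p′ = p′} {q′ = q′} p⊆p′ q⊆q′ =
    ∪-lub (⊆-trans p⊆p′ (p⊆p∪q q′)) (⊆-trans q⊆q′ (q⊆p∪q p′ q′))

  ∩-mono : {p p′ q q′ : Subset n} → p ⊆ p′ → q ⊆ q′ → p ∩ q ⊆ p′ ∩ q′
  ∩-mono {p} {q = q} p⊆p′ q⊆q′ x∈p∩q =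
    let (x∈p , x∈q) = x∈p∩q⁻ p q x∈p∩q in x∈p∩q⁺ (p⊆p′ x∈p , q⊆q′ x∈q)

  ⁅x⁆⊆p : {x : Fin n} {p : Subset n} → x ∈ p → ⁅ x ⁆ ⊆ p
  ⁅x⁆⊆p {x} x∈p y∈⁅x⁆ = subst (_∈ _) (sym (x∈⁅y⁆⇒x≡y x y∈⁅x⁆)) x∈p

  p⊆[p∩q]∪[p─q] : (p q : Subset n) → p ⊆ (p ∩ q) ∪ (p ─ q)
  p⊆[p∩q]∪[p─q] p q {x} x∈p with x ∈? q
  ... | yes x∈q = x∈p∪q⁺ (inj₁ (x∈p∩q⁺ (x∈p , x∈q)))
  ... | no  x∉q = x∈p∪q⁺ (inj₂ (x∈p∧x∉q⇒x∈p─q x∈p x∉q))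

∣p∪q∣+∣p∩q∣≡∣p∣+∣q∣ : ∀ {n} (p q : Subset n) → ∣ p ∪ q ∣ + ∣ p ∩ q ∣ ≡ ∣ p ∣ + ∣ q ∣
∣p∪q∣+∣p∩q∣≡∣p∣+∣q∣ []          []          = refl
∣p∪q∣+∣p∩q∣≡∣p∣+∣q∣ (true  ∷ p) (true  ∷ q) =
  cong suc (trans (+-suc _ _) (trans (cong suc (∣p∪q∣+∣p∩q∣≡∣p∣+∣q∣ p q)) (sym (+-suc _ _))))
∣p∪q∣+∣p∩q∣≡∣p∣+∣q∣ (true  ∷ p) (false ∷ q) = cong suc (∣p∪q∣+∣p∩q∣≡∣p∣+∣q∣ p q)
∣p∪q∣+∣p∩q∣≡∣p∣+∣q∣ (false ∷ p) (true  ∷ q) =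
  trans (cong suc (∣p∪q∣+∣p∩q∣≡∣p∣+∣q∣ p q)) (sym (+-suc _ _))
∣p∪q∣+∣p∩q∣≡∣p∣+∣q∣ (false ∷ p) (false ∷ q) = ∣p∪q∣+∣p∩q∣≡∣p∣+∣q∣ p q

∣p∪q∣≤∣p∣+∣q∣ : ∀ {n} (p q : Subset n) → ∣ p ∪ q ∣ ≤ ∣ p ∣ + ∣ q ∣
∣p∪q∣≤∣p∣+∣q∣ p q = subst (∣ p ∪ q ∣ ≤_) (∣p∪q∣+∣p∩q∣≡∣p∣+∣q∣ p q) (m≤m+n _ _)

∣p∪q∣≡∣p∣+∣q∣ : ∀ {n} (p q : Subset n) → (∀ {x} → x ∈ p → x ∉ q) → ∣ p ∪ q ∣ ≡ ∣ p ∣ + ∣ q ∣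
∣p∪q∣≡∣p∣+∣q∣ {n} p q disjoint = begin
  ∣ p ∪ q ∣             ≡⟨ sym (+-identityʳ _) ⟩
  ∣ p ∪ q ∣ + 0         ≡⟨ cong (∣ p ∪ q ∣ +_) (sym (∣⊥∣≡0 n)) ⟩
  ∣ p ∪ q ∣ + ∣ ⊥ {n} ∣ ≡⟨ cong (λ s → ∣ p ∪ q ∣ + ∣ s ∣) (sym p∩q≡⊥) ⟩
  ∣ p ∪ q ∣ + ∣ p ∩ q ∣ ≡⟨ ∣p∪q∣+∣p∩q∣≡∣p∣+∣q∣ p q ⟩
  ∣ p ∣ + ∣ q ∣         ∎
  where
  open ≡-Reasoning
  p∩q≡⊥ : p ∩ q ≡ ⊥
  p∩q≡⊥ = Empty-unique λ (x , x∈p∩q) →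
    let (x∈p , x∈q) = x∈p∩q⁻ p q x∈p∩q in disjoint x∈p x∈q

∣p∣≡∣p∩q∣+∣p─q∣ : ∀ {n} (p q : Subset n) → ∣ p ∣ ≡ ∣ p ∩ q ∣ + ∣ p ─ q ∣
∣p∣≡∣p∩q∣+∣p─q∣ []          []          = refl
∣p∣≡∣p∩q∣+∣p─q∣ (true  ∷ p) (true  ∷ q) = cong suc (∣p∣≡∣p∩q∣+∣p─q∣ p q)
∣p∣≡∣p∩q∣+∣p─q∣ (true  ∷ p) (false ∷ q) = trans (cong suc (∣p∣≡∣p∩q∣+∣p─q∣ p q)) (sym (+-suc _ _))
∣p∣≡∣p∩q∣+∣p─q∣ (false ∷ p) (true  ∷ q) = ∣p∣≡∣p∩q∣+∣p─q∣ p q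
∣p∣≡∣p∩q∣+∣p─q∣ (false ∷ p) (false ∷ q) = ∣p∣≡∣p∩q∣+∣p─q∣ p q

module _ {n : ℕ} where

  x∈tabulate⁺ : ∀ {f : Fin n → Bool.Bool} {x} → f x ≡ true → x ∈ tabulate f
  x∈tabulate⁺ {f} {x} fx≡true = lookup⇒[]= x (tabulate f) (trans (lookup∘tabulate f x) fx≡true)

  x∈tabulate⁻ : ∀ {f : Fin n → Bool.Bool} {x} → x ∈ tabulate f → f x ≡ true
  x∈tabulate⁻ {f} {x} x∈ = trans (sym (lookup∘tabulate f x)) ([]=⇒lookup x∈)

  x∈⋃⁺ : ∀ {ps : List (Subset n)} {p x} → p ∈ₗ ps → x ∈ p → x ∈ ⋃ ps
  x∈⋃⁺ (here refl) x∈p = x∈p∪q⁺ (inj₁ x∈p)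
  x∈⋃⁺ (there p∈ps) x∈p = x∈p∪q⁺ (inj₂ (x∈⋃⁺ p∈ps x∈p))

  x∈⋃⁻ : ∀ (ps : List (Subset n)) {x} → x ∈ ⋃ ps → ∃ λ p → p ∈ₗ ps × x ∈ p
  x∈⋃⁻ List.[]       x∈⋃ = ⊥-elim (∉⊥ x∈⋃)
  x∈⋃⁻ (p List.∷ ps) x∈⋃ with x∈p∪q⁻ p (⋃ ps) x∈⋃
  ... | inj₁ x∈p = p , here refl , x∈p
  ... | inj₂ x∈⋃ps = let (q , q∈ps , x∈q) = x∈⋃⁻ ps x∈⋃ps in q , there q∈ps , x∈q

module _ {m n : ℕ} (ι : Fin m → Fin n) where

  private
    pointImage : Subset m → Fin m → Subset n
    pointImage X i = if lookup X i then ⁅ ι i ⁆ else ⊥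

    ∈-if⁺ : ∀ {b} {x : Fin n} → b ≡ true → x ∈ (if b then ⁅ x ⁆ else ⊥)
    ∈-if⁺ {x = x} refl = x∈⁅x⁆ x

    ∈-if⁻ : ∀ {b x} {y : Fin n} → x ∈ (if b then ⁅ y ⁆ else ⊥) → b ≡ true × y ≡ x
    ∈-if⁻ {true}  {y = y} x∈⁅y⁆ = refl , sym (x∈⁅y⁆⇒x≡y y x∈⁅y⁆)
    ∈-if⁻ {false} x∈⊥ = ⊥-elim (∉⊥ x∈⊥)

  x∈image⁺ : ∀ {X i} → i ∈ X → ι i ∈ image ι X
  x∈image⁺ {X} {i} i∈X =
    x∈⋃⁺ (∈-map⁺ (pointImage X) (∈-allFin i)) (∈-if⁺ ([]=⇒lookup i∈X))

  x∈image⁻ : ∀ {X y} → y ∈ image ι X → ∃ λ i → i ∈ X × ι i ≡ y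
  x∈image⁻ {X} y∈ with x∈⋃⁻ (map (pointImage X) (allFin m)) y∈
  ... | _ , p∈ , y∈p with ∈-map⁻ (pointImage X) p∈
  ... | i , _ , refl = let (Xi≡true , ιi≡y) = ∈-if⁻ y∈p in i , lookup⇒[]= i X Xi≡true , ιi≡y

  image-mono : ∀ {X X′} → X ⊆ X′ → image ι X ⊆ image ι X′
  image-mono {X} X⊆X′ y∈ with x∈image⁻ {X} y∈
  ... | i , i∈X , refl = x∈image⁺ (X⊆X′ i∈X)

  preimage : Subset n → Subset m
  preimage F = tabulate (λ i → lookup F (ι i))

  x∈preimage⁺ : ∀ {F i} → ι i ∈ F → i ∈ preimage F
  x∈preimage⁺ ιi∈F = x∈tabulate⁺ ([]=⇒lookup ιi∈F)

  x∈preimage⁻ : ∀ {F i} → i ∈ preimage F → ι i ∈ F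
  x∈preimage⁻ {F} {i} i∈ = lookup⇒[]= (ι i) F (x∈tabulate⁻ i∈)

  image-preimage⊆ : ∀ F → image ι (preimage F) ⊆ F
  image-preimage⊆ F y∈ with x∈image⁻ {preimage F} y∈
  ... | i , i∈ , refl = x∈preimage⁻ i∈

  image∩⊆image[∩preimage] : ∀ X F → image ι X ∩ F ⊆ image ι (X ∩ preimage F)
  image∩⊆image[∩preimage] X F y∈ with x∈p∩q⁻ (image ι X) F y∈
  ... | y∈ιX , y∈F with x∈image⁻ {X} y∈ιX
  ... | i , i∈X , refl = x∈image⁺ {X ∩ preimage F} (x∈p∩q⁺ (i∈X , x∈preimage⁺ y∈F))

image-∷ : ∀ {m n} (ι : Fin (suc m) → Fin n) b X →
  image ι (b ∷ X) ≡ (if b then ⁅ ι zero ⁆ else ⊥) ∪ image (ι ∘ suc) X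
image-∷ {m} ι b X = cong ((if b then ⁅ ι zero ⁆ else ⊥) ∪_) (cong ⋃
  (trans (map-tabulate suc pointImage) (sym (map-tabulate id (pointImage ∘ suc)))))
  where
  pointImage : Fin (suc m) → Subset _
  pointImage i = if lookup (b ∷ X) i then ⁅ ι i ⁆ else ⊥

∣image∣≡∣p∣ : ∀ {m n} {ι : Fin m → Fin n} → Injective _≡_ _≡_ ι → ∀ X → ∣ image ι X ∣ ≡ ∣ X ∣
∣image∣≡∣p∣ {zero}  {n} _ [] = ∣⊥∣≡0 n
∣image∣≡∣p∣ {suc m} {ι = ι} ι-inj (false ∷ X) = begin
  ∣ image ι (false ∷ X) ∣   ≡⟨ cong ∣_∣ (trans (image-∷ ι false X) (∪-identityˡ _)) ⟩
  ∣ image (ι ∘ suc) X ∣     ≡⟨ ∣image∣≡∣p∣ (suc-injective ∘ ι-inj) X ⟩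
  ∣ X ∣                     ∎
  where open ≡-Reasoning
∣image∣≡∣p∣ {suc m} {ι = ι} ι-inj (true ∷ X) = begin
  ∣ image ι (true ∷ X) ∣                  ≡⟨ cong ∣_∣ (image-∷ ι true X) ⟩
  ∣ ⁅ ι zero ⁆ ∪ image (ι ∘ suc) X ∣      ≡⟨ ∣p∪q∣≡∣p∣+∣q∣ _ _ ι0∉ιsucX ⟩
  ∣ ⁅ ι zero ⁆ ∣ + ∣ image (ι ∘ suc) X ∣
    ≡⟨ cong₂ _+_ (∣⁅x⁆∣≡1 (ι zero)) (∣image∣≡∣p∣ (suc-injective ∘ ι-inj) X) ⟩
  suc ∣ X ∣                               ∎
  where
  open ≡-Reasoning
  ι0∉ιsucX : ∀ {y} → y ∈ ⁅ ι zero ⁆ → y ∉ image (ι ∘ suc) X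
  ι0∉ιsucX y∈⁅ι0⁆ y∈ with x∈image⁻ (ι ∘ suc) {X} y∈
  ... | i , _ , ιsuci≡y with ι-inj (trans ιsuci≡y (x∈⁅y⁆⇒x≡y (ι zero) y∈⁅ι0⁆))
  ... | ()

module MatroidProperties {n : ℕ} (M : Matroid n) where

  ρ : Subset n → ℕ
  ρ = rank M

  rank-sub-⊆ : ∀ {X Y Z} → Z ⊆ X → Z ⊆ Y → ρ (X ∪ Y) + ρ Z ≤ ρ X + ρ Y
  rank-sub-⊆ {X} {Y} Z⊆X Z⊆Y =
    ≤-trans (+-monoʳ-≤ (ρ (X ∪ Y)) (rank-mono M (λ x∈Z → x∈p∩q⁺ (Z⊆X x∈Z , Z⊆Y x∈Z))))
            (rank-sub M X Y)

  rank-∪-≤ : ∀ S T → ρ (S ∪ T) ≤ ρ S + ∣ T ∣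
  rank-∪-≤ S T = ≤-trans (m≤m+n _ _) (≤-trans (rank-sub M S T) (+-monoʳ-≤ (ρ S) (rank-≤ M T)))

  rank-∪-≤-─ : ∀ S T → ρ (S ∪ T) ≤ ρ S + ∣ T ─ S ∣
  rank-∪-≤-─ S T = ≤-trans (rank-mono M S∪T⊆S∪[T─S]) (rank-∪-≤ S (T ─ S))
    where
    S∪T⊆S∪[T─S] : S ∪ T ⊆ S ∪ (T ─ S)
    S∪T⊆S∪[T─S] = ∪-lub (p⊆p∪q _)
      (⊆-trans (p⊆[p∩q]∪[p─q] T S) (∪-mono (p∩q⊆q T S) ⊆-refl))

  Spans : Subset n → Subset n → Set
  Spans S B = ρ (S ∪ B) ≤ ρ S

  spans? : ∀ S B → Dec (Spans S B)
  spans? S B = ρ (S ∪ B) ≤? ρ S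

  spans-⊆ : ∀ {S B} → B ⊆ S → Spans S B
  spans-⊆ B⊆S = rank-mono M (∪-lub ⊆-refl B⊆S)

  spans-antimono : ∀ {S B B′} → B′ ⊆ B → Spans S B → Spans S B′
  spans-antimono B′⊆B = ≤-trans (rank-mono M (∪-mono ⊆-refl B′⊆B))

  spans-mono : ∀ {T S B} → T ⊆ S → Spans T B → Spans S B
  spans-mono {T} {S} {B} T⊆S T-spans = +-cancelʳ-≤ (ρ T) _ _ (begin
    ρ (S ∪ B) + ρ T        ≤⟨ +-monoˡ-≤ (ρ T) (rank-mono M S∪B⊆) ⟩
    ρ ((T ∪ B) ∪ S) + ρ T  ≤⟨ rank-sub-⊆ (p⊆p∪q B) T⊆S ⟩
    ρ (T ∪ B) + ρ S        ≤⟨ +-monoˡ-≤ (ρ S) T-spans ⟩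
    ρ T + ρ S              ≡⟨ +-comm (ρ T) (ρ S) ⟩
    ρ S + ρ T              ∎)
    where
    open ≤-Reasoning
    S∪B⊆ : S ∪ B ⊆ (T ∪ B) ∪ S
    S∪B⊆ = ∪-lub (q⊆p∪q _ S) (⊆-trans (q⊆p∪q T B) (p⊆p∪q S))

  spans-∪ : ∀ {S B B′} → Spans S B → Spans S B′ → Spans S (B ∪ B′)
  spans-∪ {S} {B} {B′} S-spans-B S-spans-B′ = +-cancelʳ-≤ (ρ S) _ _ (begin
    ρ (S ∪ (B ∪ B′)) + ρ S         ≤⟨ +-monoˡ-≤ (ρ S) (rank-mono M S∪B∪B′⊆) ⟩
    ρ ((S ∪ B) ∪ (S ∪ B′)) + ρ S   ≤⟨ rank-sub-⊆ (p⊆p∪q B) (p⊆p∪q B′) ⟩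
    ρ (S ∪ B) + ρ (S ∪ B′)         ≤⟨ +-mono-≤ S-spans-B S-spans-B′ ⟩
    ρ S + ρ S                      ∎)
    where
    open ≤-Reasoning
    S∪B∪B′⊆ : S ∪ (B ∪ B′) ⊆ (S ∪ B) ∪ (S ∪ B′)
    S∪B∪B′⊆ = ∪-lub (⊆-trans (p⊆p∪q B) (p⊆p∪q _)) (∪-mono (q⊆p∪q S B) (q⊆p∪q S B′))

  spans-⋃ : ∀ {S} (Bs : List (Subset n)) → All (Spans S) Bs → Spans S (⋃ Bs)
  spans-⋃ List.[]       All.[]             = spans-⊆ ⊥⊆
  spans-⋃ (B List.∷ Bs) (S-spans-B All.∷ rest) = spans-∪ S-spans-B (spans-⋃ Bs rest)

  spans-pointwise : ∀ {S B} → (∀ {e} → e ∈ B → Spans S ⁅ e ⁆) → Spans S B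
  spans-pointwise {S} {B} spans-each =
    spans-antimono B⊆⋃ (spans-⋃ (map piece (allFin n)) (map⁺ (All.tabulate λ {e} _ → piece-spanned e)))
    where
    piece : Fin n → Subset n
    piece e = B ∩ ⁅ e ⁆

    B⊆⋃ : B ⊆ ⋃ (map piece (allFin n))
    B⊆⋃ {e} e∈B = x∈⋃⁺ (∈-map⁺ piece (∈-allFin e)) (x∈p∩q⁺ (e∈B , x∈⁅x⁆ e))

    piece-spanned : ∀ e → Spans S (piece e)
    piece-spanned e with e ∈? B
    ... | yes e∈B = spans-antimono (p∩q⊆q B ⁅ e ⁆) (spans-each e∈B)
    ... | no  e∉B = spans-antimono piece⊆⊥ (spans-⊆ ⊥⊆)
      where
      piece⊆⊥ : piece e ⊆ ⊥
      piece⊆⊥ x∈ = let (x∈B , x∈⁅e⁆) = x∈p∩q⁻ B ⁅ e ⁆ x∈ in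
        ⊥-elim (e∉B (subst (_∈ B) (x∈⁅y⁆⇒x≡y e x∈⁅e⁆) x∈B))

  spans-⊤⇒rank≡r : ∀ {S} → Spans S ⊤ → ρ S ≡ r M
  spans-⊤⇒rank≡r S-spans-⊤ =
    ≤-antisym (rank-mono M ⊆⊤) (≤-trans (rank-mono M (q⊆p∪q _ ⊤)) S-spans-⊤)

  closure : Subset n → Subset n
  closure S = tabulate (λ e → isYes (spans? S ⁅ e ⁆))

  x∈closure⁺ : ∀ {S e} → Spans S ⁅ e ⁆ → e ∈ closure S
  x∈closure⁺ {S} {e} spans = x∈tabulate⁺ (Equivalence.to T-≡ (fromWitness {a? = spans? S ⁅ e ⁆} spans))

  x∈closure⁻ : ∀ {S e} → e ∈ closure S → Spans S ⁅ e ⁆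
  x∈closure⁻ {S} {e} e∈ = toWitness {a? = spans? S ⁅ e ⁆} (Equivalence.from T-≡ (x∈tabulate⁻ e∈))

  ⊆-closure : ∀ S → S ⊆ closure S
  ⊆-closure S e∈S = x∈closure⁺ (spans-⊆ (⁅x⁆⊆p e∈S))

  rank-closure : ∀ S → ρ (closure S) ≡ ρ S
  rank-closure S = ≤-antisym
    (≤-trans (rank-mono M (q⊆p∪q S _)) (spans-pointwise x∈closure⁻))
    (rank-mono M (⊆-closure S))

  closure-isFlat : ∀ S → IsFlat M (closure S)
  closure-isFlat S e e∉ = begin-strict
    ρ (closure S)          ≡⟨ rank-closure S ⟩
    ρ S                    <⟨ ≰⇒> (e∉ ∘ x∈closure⁺) ⟩
    ρ (S ∪ ⁅ e ⁆)          ≤⟨ rank-mono M (∪-mono (⊆-closure S) ⊆-refl) ⟩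
    ρ (closure S ∪ ⁅ e ⁆)  ∎
    where open ≤-Reasoning

  -- K is independent in M / A; the reverse inequality always holds.
  IndependentOver : Subset n → Subset n → Set
  IndependentOver A K = ρ A + ∣ K ∣ ≤ ρ (A ∪ K)

  independentOver⇒rank≡ : ∀ {A K} → IndependentOver A K → ρ (A ∪ K) ≡ ρ A + ∣ K ∣
  independentOver⇒rank≡ {A} {K} = ≤-antisym (rank-∪-≤ A K)

  independentOver-⊥ : ∀ A → IndependentOver A ⊥
  independentOver-⊥ A = begin
    ρ A + ∣ ⊥ {n} ∣  ≡⟨ cong (ρ A +_) (∣⊥∣≡0 n) ⟩
    ρ A + 0          ≡⟨ +-identityʳ (ρ A) ⟩
    ρ A              ≤⟨ rank-mono M (p⊆p∪q ⊥) ⟩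
    ρ (A ∪ ⊥)        ∎
    where open ≤-Reasoning

  independentOver-∪⁅⁆ : ∀ {A K e} → IndependentOver A K → ¬ Spans (A ∪ K) ⁅ e ⁆ →
    IndependentOver A (K ∪ ⁅ e ⁆)
  independentOver-∪⁅⁆ {A} {K} {e} indep ¬spans = begin
    ρ A + ∣ K ∪ ⁅ e ⁆ ∣        ≤⟨ +-monoʳ-≤ (ρ A) (∣p∪q∣≤∣p∣+∣q∣ K ⁅ e ⁆) ⟩
    ρ A + (∣ K ∣ + ∣ ⁅ e ⁆ ∣)  ≡⟨ cong (λ k → ρ A + (∣ K ∣ + k)) (∣⁅x⁆∣≡1 e) ⟩
    ρ A + (∣ K ∣ + 1)          ≡⟨ sym (+-assoc (ρ A) ∣ K ∣ 1) ⟩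
    ρ A + ∣ K ∣ + 1            ≤⟨ +-monoˡ-≤ 1 indep ⟩
    ρ (A ∪ K) + 1              ≡⟨ +-comm (ρ (A ∪ K)) 1 ⟩
    suc (ρ (A ∪ K))            ≤⟨ ≰⇒> ¬spans ⟩
    ρ ((A ∪ K) ∪ ⁅ e ⁆)        ≡⟨ cong ρ (∪-assoc A K ⁅ e ⁆) ⟩
    ρ (A ∪ (K ∪ ⁅ e ⁆))        ∎
    where open ≤-Reasoning

  independentOver-∩ : ∀ {A J} F → IndependentOver A J → IndependentOver A (J ∩ F)
  independentOver-∩ {A} {J} F indep = +-cancelʳ-≤ ∣ J ─ F ∣ _ _ (begin
    ρ A + ∣ J ∩ F ∣ + ∣ J ─ F ∣        ≡⟨ +-assoc (ρ A) _ _ ⟩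
    ρ A + (∣ J ∩ F ∣ + ∣ J ─ F ∣)      ≡⟨ cong (ρ A +_) (sym (∣p∣≡∣p∩q∣+∣p─q∣ J F)) ⟩
    ρ A + ∣ J ∣                        ≤⟨ indep ⟩
    ρ (A ∪ J)                          ≤⟨ rank-mono M A∪J⊆ ⟩
    ρ ((A ∪ (J ∩ F)) ∪ (J ─ F))        ≤⟨ rank-∪-≤ (A ∪ (J ∩ F)) (J ─ F) ⟩
    ρ (A ∪ (J ∩ F)) + ∣ J ─ F ∣        ∎)
    where
    open ≤-Reasoning
    A∪J⊆ : A ∪ J ⊆ (A ∪ (J ∩ F)) ∪ (J ─ F)
    A∪J⊆ = ∪-lub (⊆-trans (p⊆p∪q _) (p⊆p∪q _))
                 (⊆-trans (p⊆[p∩q]∪[p─q] J F) (∪-mono (q⊆p∪q A _) ⊆-refl))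

  independentOver-antimono : ∀ {A A′ K} → A′ ⊆ A → IndependentOver A K → IndependentOver A′ K
  independentOver-antimono {A} {A′} {K} A′⊆A indep = +-cancelʳ-≤ (ρ A) _ _ (begin
    ρ A′ + ∣ K ∣ + ρ A          ≡⟨ +-assoc (ρ A′) _ _ ⟩
    ρ A′ + (∣ K ∣ + ρ A)        ≡⟨ cong (ρ A′ +_) (+-comm ∣ K ∣ (ρ A)) ⟩
    ρ A′ + (ρ A + ∣ K ∣)        ≤⟨ +-monoʳ-≤ (ρ A′) indep ⟩
    ρ A′ + ρ (A ∪ K)            ≡⟨ +-comm (ρ A′) _ ⟩
    ρ (A ∪ K) + ρ A′            ≤⟨ +-monoˡ-≤ (ρ A′) (rank-mono M A∪K⊆) ⟩
    ρ ((A′ ∪ K) ∪ A) + ρ A′     ≤⟨ rank-sub-⊆ (p⊆p∪q K) A′⊆A ⟩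
    ρ (A′ ∪ K) + ρ A            ∎)
    where
    open ≤-Reasoning
    A∪K⊆ : A ∪ K ⊆ (A′ ∪ K) ∪ A
    A∪K⊆ = ∪-lub (q⊆p∪q _ A) (⊆-trans (q⊆p∪q A′ K) (p⊆p∪q A))

  independentOver-disjoint : ∀ {A K e} → IndependentOver A K → e ∈ K → e ∉ A
  independentOver-disjoint {A} {K} {e} indep e∈K e∈A = <⇒≱ (begin-strict
    ρ (A ∪ K)          ≤⟨ rank-mono M (∪-lub (p⊆p∪q _) K⊆A∪[K-e]) ⟩
    ρ (A ∪ (K - e))    ≤⟨ rank-∪-≤ A (K - e) ⟩
    ρ A + ∣ K - e ∣    <⟨ +-monoʳ-< (ρ A) (x∈p⇒∣p-x∣<∣p∣ e∈K) ⟩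
    ρ A + ∣ K ∣        ∎) indep
    where
    open ≤-Reasoning
    K⊆A∪[K-e] : K ⊆ A ∪ (K - e)
    K⊆A∪[K-e] {x} x∈K with x ≟ᶠ e
    ... | yes refl = x∈p∪q⁺ (inj₁ e∈A)
    ... | no  x≢e  = x∈p∪q⁺ (inj₂ (x∈p∧x≢y⇒x∈p-y x∈K x≢e))

  record BasisOver (A B : Subset n) : Set where
    field
      basis       : Subset n
      basis⊆      : basis ⊆ B
      independent : IndependentOver A basis
      spanning    : Spans (A ∪ basis) B

  module _ (A B : Subset n) where

    private
      Extension : Subset n → List (Fin n) → Set
      Extension K es = ∃ λ K′ → K ⊆ K′ × K′ ⊆ B × IndependentOver A K′
                                × (∀ {e} → e ∈ₗ es → e ∈ B → Spans (A ∪ K′) ⁅ e ⁆)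

    extendBy : ∀ {K} → K ⊆ B → IndependentOver A K → ∀ e → Extension K (e List.∷ List.[])
    extendBy {K} K⊆B indep e with e ∈? B | spans? (A ∪ K) ⁅ e ⁆
    ... | yes e∈B | no ¬spans =
      K ∪ ⁅ e ⁆ , p⊆p∪q ⁅ e ⁆ , ∪-lub K⊆B (⁅x⁆⊆p e∈B) , independentOver-∪⁅⁆ indep ¬spans ,
      λ { (here refl) _ → spans-⊆ (⊆-trans (q⊆p∪q K ⁅ e ⁆) (q⊆p∪q A _)) }
    ... | yes _   | yes spans = K , ⊆-refl , K⊆B , indep , λ { (here refl) _ → spans }
    ... | no  e∉B | _         = K , ⊆-refl , K⊆B , indep , λ { (here refl) e∈B → ⊥-elim (e∉B e∈B) }

    extend : ∀ {K} → K ⊆ B → IndependentOver A K → (es : List (Fin n)) → Extension K es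
    extend K⊆B indep List.[] = _ , ⊆-refl , K⊆B , indep , λ ()
    extend K⊆B indep (e List.∷ es) =
      let (K₁ , K⊆K₁ , K₁⊆B , indep₁ , e-spanned)   = extendBy K⊆B indep e
          (K₂ , K₁⊆K₂ , K₂⊆B , indep₂ , es-spanned) = extend K₁⊆B indep₁ es
      in K₂ , ⊆-trans K⊆K₁ K₁⊆K₂ , K₂⊆B , indep₂ ,
         λ { (here refl) e∈B → spans-mono (∪-mono ⊆-refl K₁⊆K₂) (e-spanned (here refl) e∈B)
           ; (there e∈es)     → es-spanned e∈es }

    basisOver : BasisOver A B
    basisOver =
      let (K , _ , K⊆B , indep , spanned) = extend ⊥⊆ (independentOver-⊥ A) (allFin n)
      in record { basis = K ; basis⊆ = K⊆B ; independent = indep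
                ; spanning = spans-pointwise (spanned (∈-allFin _)) }

  rank≡∣basis∣ : ∀ {B} (I : BasisOver ⊥ B) → ρ B ≡ ∣ BasisOver.basis I ∣
  rank≡∣basis∣ {B} I = ≤-antisym
    (begin
      ρ B              ≤⟨ rank-mono M (q⊆p∪q _ B) ⟩
      ρ ((⊥ ∪ K) ∪ B)  ≤⟨ spanning ⟩
      ρ (⊥ ∪ K)        ≤⟨ rank-∪-≤ ⊥ K ⟩
      ρ ⊥ + ∣ K ∣      ≡⟨ cong (_+ ∣ K ∣) (n≤0⇒n≡0 ρ⊥≤0) ⟩
      ∣ K ∣            ∎)
    (begin
      ∣ K ∣            ≤⟨ m≤n+m ∣ K ∣ (ρ ⊥) ⟩
      ρ ⊥ + ∣ K ∣      ≤⟨ independent ⟩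
      ρ (⊥ ∪ K)        ≡⟨ cong ρ (∪-identityˡ K) ⟩
      ρ K              ≤⟨ rank-mono M basis⊆ ⟩
      ρ B              ∎)
    where
    open ≤-Reasoning
    open BasisOver I renaming (basis to K)
    ρ⊥≤0 : ρ ⊥ ≤ 0
    ρ⊥≤0 = ≤-trans (rank-≤ M ⊥) (≤-reflexive (∣⊥∣≡0 n))

module MinorCover {m n : ℕ} {N : Matroid m} {M : Matroid n} (minor : IsMinor N M) where

  open IsMinor minor
  open MatroidProperties M
  module N = MatroidProperties N

  A : Subset n
  A = image ι ⊤ ∪ C

  open BasisOver (basisOver ⊥ C) using ()
    renaming (basis to I; basis⊆ to I⊆C; spanning to ⊥∪I-spans-C)
  open BasisOver (basisOver A ⊤) using ()
    renaming (basis to J; independent to J-independent; spanning to J-spanning)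

  rank-C : ρ C ≡ ∣ I ∣
  rank-C = rank≡∣basis∣ (basisOver ⊥ C)

  I-spans-C : Spans I C
  I-spans-C = spans-mono (⊆-reflexive (∪-identityˡ I)) ⊥∪I-spans-C

  r[M]≡ : r M ≡ ρ A + ∣ J ∣
  r[M]≡ = trans (sym (spans-⊤⇒rank≡r J-spanning)) (independentOver⇒rank≡ J-independent)

  lift : Subset m → Subset n
  lift X = (image ι X ∪ I) ∪ J

  restrict : Subset n → Subset m
  restrict F = N.closure (preimage ι F)

  ∣lift∣ : ∀ X → ∣ lift X ∣ ≡ ∣ X ∣ + ∣ I ∣ + ∣ J ∣
  ∣lift∣ X = begin
    ∣ (image ι X ∪ I) ∪ J ∣           ≡⟨ ∣p∪q∣≡∣p∣+∣q∣ _ J ιX∪I∉J ⟩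
    ∣ image ι X ∪ I ∣ + ∣ J ∣         ≡⟨ cong (_+ ∣ J ∣) (∣p∪q∣≡∣p∣+∣q∣ _ I ιX∉I) ⟩
    ∣ image ι X ∣ + ∣ I ∣ + ∣ J ∣     ≡⟨ cong (λ k → k + ∣ I ∣ + ∣ J ∣) (∣image∣≡∣p∣ ι-inj X) ⟩
    ∣ X ∣ + ∣ I ∣ + ∣ J ∣             ∎
    where
    open ≡-Reasoning
    ιX∉I : ∀ {y} → y ∈ image ι X → y ∉ I
    ιX∉I y∈ιX y∈I with x∈image⁻ ι {X} y∈ιX
    ... | i , _ , refl = disjoint i (I⊆C y∈I)
    ιX∪I∉J : ∀ {y} → y ∈ image ι X ∪ I → y ∉ J
    ιX∪I∉J y∈ y∈J = independentOver-disjoint J-independent y∈J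
      (∪-mono (image-mono ι {X} {⊤} ⊆⊤) I⊆C y∈)

  lift-nonBasis : ∀ {X} → NonBasis N X → NonBasis M (lift X)
  lift-nonBasis {X} (∣X∣≡r , ¬basis) = ∣lift∣≡r , λ (independent , _) → <⇒≢ rank<∣lift∣ independent
    where
    ρC≤ρA : ρ C ≤ ρ A
    ρC≤ρA = rank-mono M (q⊆p∪q _ C)

    ∣lift∣≡r : ∣ lift X ∣ ≡ r M
    ∣lift∣≡r = begin
      ∣ lift X ∣                    ≡⟨ ∣lift∣ X ⟩
      ∣ X ∣ + ∣ I ∣ + ∣ J ∣
        ≡⟨ cong₂ (λ x i → x + i + ∣ J ∣) (trans ∣X∣≡r (rank-eq ⊤)) (sym rank-C) ⟩
      (ρ A ∸ ρ C) + ρ C + ∣ J ∣     ≡⟨ cong (_+ ∣ J ∣) (m∸n+n≡m ρC≤ρA) ⟩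
      ρ A + ∣ J ∣                   ≡⟨ sym r[M]≡ ⟩
      r M                           ∎
      where open ≡-Reasoning

    rank[ιX∪C]< : ρ (image ι X ∪ C) < ∣ X ∣ + ρ C
    rank[ιX∪C]< = m∸n<o⇒m<o+n (rank-mono M (q⊆p∪q _ C))
      (subst (_< ∣ X ∣) (rank-eq X) (≤∧≢⇒< (rank-≤ N X) (λ eq → ¬basis (eq , ∣X∣≡r))))

    rank<∣lift∣ : ρ (lift X) < ∣ lift X ∣
    rank<∣lift∣ = begin-strict
      ρ ((image ι X ∪ I) ∪ J)    ≤⟨ rank-∪-≤ _ J ⟩
      ρ (image ι X ∪ I) + ∣ J ∣  ≤⟨ +-monoˡ-≤ ∣ J ∣ (rank-mono M (∪-mono ⊆-refl I⊆C)) ⟩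
      ρ (image ι X ∪ C) + ∣ J ∣  <⟨ +-monoˡ-< ∣ J ∣ rank[ιX∪C]< ⟩
      ∣ X ∣ + ρ C + ∣ J ∣        ≡⟨ cong (λ c → ∣ X ∣ + c + ∣ J ∣) rank-C ⟩
      ∣ X ∣ + ∣ I ∣ + ∣ J ∣      ≡⟨ sym (∣lift∣ X) ⟩
      ∣ lift X ∣                 ∎
      where open ≤-Reasoning

  restrict-covers : ∀ {X F} → Covers M F (lift X) → Covers N (restrict F) X
  restrict-covers {X} {F} F-covers = begin-strict
    rank N (restrict F)    ≡⟨ trans (N.rank-closure P) (rank-eq P) ⟩
    ρ A′ ∸ ρ C             <⟨ m<o+n⇒m∸n<o (rank-mono M (q⊆p∪q _ C)) rank[A′]< ⟩
    ∣ image ι X ∩ F ∣      ≤⟨ p⊆q⇒∣p∣≤∣q∣ (image∩⊆image[∩preimage] ι X F) ⟩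
    ∣ image ι (X ∩ P) ∣    ≡⟨ ∣image∣≡∣p∣ ι-inj (X ∩ P) ⟩
    ∣ X ∩ P ∣              ≤⟨ p⊆q⇒∣p∣≤∣q∣ {p = X ∩ P} (∩-mono ⊆-refl (N.⊆-closure P)) ⟩
    ∣ X ∩ restrict F ∣     ∎
    where
    open ≤-Reasoning
    P  = preimage ι F
    A′ = image ι P ∪ C
    K  = J ∩ F

    lift∩F≡ : lift X ∩ F ≡ ((image ι X ∩ F) ∪ (I ∩ F)) ∪ K
    lift∩F≡ = trans (∩-distribʳ-∪ F (image ι X ∪ I) J) (cong (_∪ K) (∩-distribʳ-∪ F (image ι X) I))

    ∣lift∩F∣≤ : ∣ lift X ∩ F ∣ ≤ ∣ image ι X ∩ F ∣ + ∣ I ∩ F ∣ + ∣ K ∣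
    ∣lift∩F∣≤ = begin
      ∣ lift X ∩ F ∣                           ≡⟨ cong ∣_∣ lift∩F≡ ⟩
      ∣ ((image ι X ∩ F) ∪ (I ∩ F)) ∪ K ∣      ≤⟨ ∣p∪q∣≤∣p∣+∣q∣ ((image ι X ∩ F) ∪ (I ∩ F)) K ⟩
      ∣ (image ι X ∩ F) ∪ (I ∩ F) ∣ + ∣ K ∣
        ≤⟨ +-monoˡ-≤ ∣ K ∣ (∣p∪q∣≤∣p∣+∣q∣ (image ι X ∩ F) (I ∩ F)) ⟩
      ∣ image ι X ∩ F ∣ + ∣ I ∩ F ∣ + ∣ K ∣    ∎

    A′⊆A : A′ ⊆ A
    A′⊆A = ∪-mono (image-mono ι {P} {⊤} ⊆⊤) ⊆-refl

    A′∪K⊆F∪C : A′ ∪ K ⊆ F ∪ C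
    A′∪K⊆F∪C = ∪-lub (∪-mono (image-preimage⊆ ι F) ⊆-refl) (⊆-trans (p∩q⊆q J F) (p⊆p∪q C))

    rank[A′]< : ρ A′ < ∣ image ι X ∩ F ∣ + ρ C
    rank[A′]< = +-cancelʳ-< ∣ K ∣ _ _ (begin-strict
      ρ A′ + ∣ K ∣
        ≤⟨ independentOver-antimono A′⊆A (independentOver-∩ F J-independent) ⟩
      ρ (A′ ∪ K)
        ≤⟨ rank-mono M A′∪K⊆F∪C ⟩
      ρ (F ∪ C)
        ≤⟨ rank-mono M (∪-mono (p⊆p∪q I) ⊆-refl) ⟩
      ρ ((F ∪ I) ∪ C)
        ≤⟨ spans-mono (q⊆p∪q F I) I-spans-C ⟩
      ρ (F ∪ I)
        ≤⟨ rank-∪-≤-─ F I ⟩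
      ρ F + ∣ I ─ F ∣
        <⟨ +-monoˡ-< ∣ I ─ F ∣ F-covers ⟩
      ∣ lift X ∩ F ∣ + ∣ I ─ F ∣
        ≤⟨ +-monoˡ-≤ ∣ I ─ F ∣ ∣lift∩F∣≤ ⟩
      ∣ image ι X ∩ F ∣ + ∣ I ∩ F ∣ + ∣ K ∣ + ∣ I ─ F ∣
        ≡⟨ rearrange (∣ image ι X ∩ F ∣) (∣ I ∩ F ∣) (∣ K ∣) (∣ I ─ F ∣) ⟩
      ∣ image ι X ∩ F ∣ + (∣ I ∩ F ∣ + ∣ I ─ F ∣) + ∣ K ∣
        ≡⟨ cong (λ i → ∣ image ι X ∩ F ∣ + i + ∣ K ∣) (sym (∣p∣≡∣p∩q∣+∣p─q∣ I F)) ⟩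
      ∣ image ι X ∩ F ∣ + ∣ I ∣ + ∣ K ∣
        ≡⟨ cong (λ i → ∣ image ι X ∩ F ∣ + i + ∣ K ∣) (sym rank-C) ⟩
      ∣ image ι X ∩ F ∣ + ρ C + ∣ K ∣
        ∎)
      where
      rearrange : ∀ a b k c → a + b + k + c ≡ a + (b + c) + k
      rearrange = solve-∀

  _≟ₛ_ : DecidableEquality (Subset m)
  _≟ₛ_ = ≡-dec Bool._≟_

  open import Data.List.Relation.Unary.Unique.DecPropositional.Properties _≟ₛ_
    using (deduplicate-!)

  restrictCover : List (Subset n) → List (Subset m)
  restrictCover 𝓕 = deduplicate _≟ₛ_ (map restrict 𝓕)

  restrictCover-isFlatCover : ∀ {𝓕} → IsFlatCover M 𝓕 → IsFlatCover N (restrictCover 𝓕)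
  restrictCover-isFlatCover {𝓕} (_ , _ , covers) =
    deduplicate-! (map restrict 𝓕) ,
    deduplicate⁺ _≟ₛ_ (map⁺ (All.tabulate λ {F} _ → N.closure-isFlat (preimage ι F))) ,
    λ X X-nonBasis →
      let (F , F∈𝓕 , F-covers) = covers (lift X) (lift-nonBasis X-nonBasis)
      in restrict F , ∈-deduplicate⁺ _≟ₛ_ (∈-map⁺ restrict F∈𝓕) , restrict-covers {X} F-covers

  length-restrictCover : ∀ 𝓕 → length (restrictCover 𝓕) ≤ length 𝓕
  length-restrictCover 𝓕 =
    ≤-trans (length-deduplicate _≟ₛ_ (map restrict 𝓕)) (≤-reflexive (length-map restrict 𝓕))

lemma3p4 : {m n : ℕ} (N : Matroid m) (M : Matroid n) → IsMinor N M →
    (a b : ℕ) → IsCoverComplexity N a → IsCoverComplexity M b → a ≤ b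
lemma3p4 N M minor a _ (_ , a-minimal) ((𝓕 , 𝓕-isFlatCover , refl) , _) =
  ≤-trans (a-minimal _ (restrictCover-isFlatCover 𝓕-isFlatCover)) (length-restrictCover 𝓕)
  where open MinorCover minor
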